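{- Let $\mathcal{M}$ be a regular structure and let $\emptyset\ne P\subseteq B(\mathcal{M})$ be closed under lower (respectively, upper) cones and be an $L$-property. The following are equivalent: (1) $P$ is a finite union of lower (respectively, upper) cones; (2) $P$ is a lower (respectively, upper) cone.
   Context: A structure is regular if it is relational and no two distinct signature symbols have the same interpretation. For a regular $\mathcal{M}$ with universe $M$, $\overline{\mathcal{M}}$ is a maximal regular expansion of $\mathcal{M}$ on $M$ (every finitary relation on $M$ named by exactly one symbol), $B(\mathcal{M})$ is the set of restrictions of $\overline{\mathcal{M}}$ to subsignatures (universe $M$), and $\mathcal{B}(\mathcal{M})$ is the Boolean algebra on it with union and intersection given by union/intersection of signatures, $\mathcal{N}_1\le\mathcal{N}_2$ iff $\mathcal{N}_2$ expands $\mathcal{N}_1$. Upper cone $\triangledown_\mathcal{N}=\{\mathcal{K}\in B(\mathcal{M}):\mathcal{N}\le\mathcal{K}\}$, lower cone $\triangle_\mathcal{N}=\{\mathcal{K}\in B(\mathcal{M}):\mathcal{K}\le\mathcal{N}\}$. $P$ is closed under lower (upper) cones if $\triangle_\mathcal{N}\subseteq P$ ($\triangledown_\mathcal{N}\subseteq P$) for every $\mathcal{N}\in P$. $P$ is an $L$-property if it is closed under $\cup$ and $\cap$. -}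

module Defs where

open import Data.Nat using (ℕ)
open import Data.Fin using (Fin)
open import Data.Product using (Σ; _×_; _,_; ∃-syntax)
open import Data.Sum using (_⊎_)
open import Relation.Binary.PropositionalEquality using (_≡_)
open import Function.Bundles using (_⇔_)

record Structure (M : Set) : Set₁ where
  field
    Sym    : Set
    arity  : Sym → ℕ
    interp : (s : Sym) → (Fin (arity s) → M) → Set

FinRel : Set → Set₁
FinRel M = Σ ℕ (λ n → (Fin n → M) → Set)

Regular : {M : Set} → Structure M → Set₁
Regular {M} 𝓜 = ∀ s t →
  _≡_ {A = FinRel M} (arity s , interp s) (arity t , interp t) → s ≡ t
  where open Structure 𝓜

-- The maximal regular expansion M̄ names every finitary relation on M by exactly
-- one symbol; we identify its symbols with the finitary relations themselves.
-- An element of B(M) (a restriction of M̄ to a subsignature, universe M) is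
-- thus given by its subsignature: a subset of FinRel M.
B : Set → Set₁
B M = FinRel M → Set

-- N₁ ≤ N₂ iff N₂ expands N₁ (signature inclusion).
_≤B_ : {M : Set} → B M → B M → Set₁
N₁ ≤B N₂ = ∀ r → N₁ r → N₂ r

_∪B_ : {M : Set} → B M → B M → B M
(N₁ ∪B N₂) r = N₁ r ⊎ N₂ r

_∩B_ : {M : Set} → B M → B M → B M
(N₁ ∩B N₂) r = N₁ r × N₂ r

Property : Set → Set₂
Property M = B M → Set₁

△ : {M : Set} → B M → Property M
△ N K = K ≤B N

▽ : {M : Set} → B M → Property M
▽ N K = N ≤B K

_≐_ : {M : Set} → Property M → Property M → Set₁
P ≐ Q = ∀ K → P K ⇔ Q K

NonEmpty : {M : Set} → Property M → Set₁
NonEmpty {M} P = Σ (B M) P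

ClosedLower : {M : Set} → Property M → Set₁
ClosedLower {M} P = ∀ (N K : B M) → P N → K ≤B N → P K

ClosedUpper : {M : Set} → Property M → Set₁
ClosedUpper {M} P = ∀ (N K : B M) → P N → N ≤B K → P K

LProperty : {M : Set} → Property M → Set₁
LProperty {M} P = (∀ (N K : B M) → P N → P K → P (N ∪B K))
                × (∀ (N K : B M) → P N → P K → P (N ∩B K))

FinUnion : {M : Set} → (k : ℕ) → (Fin k → Property M) → Property M
FinUnion k Ps K = Σ (Fin k) (λ i → Ps i K)

IsFinUnionOfLowerCones : {M : Set} → Property M → Set₁
IsFinUnionOfLowerCones {M} P =
  Σ ℕ (λ k → Σ (Fin k → B M) (λ Ns → P ≐ FinUnion k (λ i → △ (Ns i))))

IsFinUnionOfUpperCones : {M : Set} → Property M → Set₁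
IsFinUnionOfUpperCones {M} P =
  Σ ℕ (λ k → Σ (Fin k → B M) (λ Ns → P ≐ FinUnion k (λ i → ▽ (Ns i))))

IsLowerCone : {M : Set} → Property M → Set₁
IsLowerCone {M} P = Σ (B M) (λ N → P ≐ △ N)

IsUpperCone : {M : Set} → Property M → Set₁
IsUpperCone {M} P = Σ (B M) (λ N → P ≐ ▽ N)

-- A nonempty finite union of lower cones △ N₀ ∪ … ∪ △ Nₖ that is closed under
-- lower cones and joins is the single cone △ (N₀ ∪ … ∪ Nₖ): each Nᵢ lies in P,
-- hence so does their join, and every member lies below some Nᵢ, hence below
-- the join. Upper cones are lower cones for the reversed order, in which ∩ is
-- the join.
module Submission where

open import Defs
open import Data.Product using (_×_; _,_; Σ; proj₁; proj₂)
open import Data.Sum using (inj₁; inj₂)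
open import Data.Nat using (ℕ; zero; suc)
open import Data.Fin using (Fin; zero; suc)
open import Function.Base using (flip)
open import Function.Bundles using (_⇔_; mk⇔; Equivalence)

module JoinPreorder
  {A : Set₁} (_≼_ : A → A → Set₁)
  (≼-refl : ∀ {x} → x ≼ x)
  (≼-trans : ∀ {x y z} → x ≼ y → y ≼ z → x ≼ z)
  (_∨_ : A → A → A)
  (x≼x∨y : ∀ {x y} → x ≼ (x ∨ y))
  (y≼x∨y : ∀ {x y} → y ≼ (x ∨ y))
  where

  ⋁ : (k : ℕ) → (Fin (suc k) → A) → A
  ⋁ zero    Ns = Ns zero
  ⋁ (suc k) Ns = Ns zero ∨ ⋁ k (λ i → Ns (suc i))

  ≼-⋁ : ∀ k Ns (i : Fin (suc k)) → Ns i ≼ ⋁ k Ns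
  ≼-⋁ zero    Ns zero    = ≼-refl
  ≼-⋁ (suc k) Ns zero    = x≼x∨y
  ≼-⋁ (suc k) Ns (suc i) = ≼-trans (≼-⋁ k (λ j → Ns (suc j)) i) y≼x∨y

  ⋁-closed : (P : A → Set₁) → (∀ x y → P x → P y → P (x ∨ y)) →
             ∀ k Ns → (∀ i → P (Ns i)) → P (⋁ k Ns)
  ⋁-closed P ∨-closed zero    Ns PNs = PNs zero
  ⋁-closed P ∨-closed (suc k) Ns PNs =
    ∨-closed _ _ (PNs zero) (⋁-closed P ∨-closed k (λ i → Ns (suc i)) (λ i → PNs (suc i)))

  Cone : A → A → Set₁
  Cone N K = K ≼ N

  finUnionOfCones⇔cone :
    (P : A → Set₁) → Σ A P →
    (∀ N K → P N → K ≼ N → P K) →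
    (∀ x y → P x → P y → P (x ∨ y)) →
    (Σ ℕ λ k → Σ (Fin k → A) λ Ns → ∀ K → P K ⇔ Σ (Fin k) (λ i → Cone (Ns i) K))
    ⇔ (Σ A λ N → ∀ K → P K ⇔ Cone N K)
  finUnionOfCones⇔cone P (N₀ , PN₀) down-closed ∨-closed = mk⇔ to from
    where
    to : (Σ ℕ λ k → Σ (Fin k → A) λ Ns → ∀ K → P K ⇔ Σ (Fin k) (λ i → Cone (Ns i) K)) →
         Σ A λ N → ∀ K → P K ⇔ Cone N K
    to (zero , Ns , P≐) with Equivalence.to (P≐ N₀) PN₀
    ... | () , _
    to (suc k , Ns , P≐) = ⋁ k Ns , λ K → mk⇔
      (λ PK → let i , K≼Nᵢ = Equivalence.to (P≐ K) PK in ≼-trans K≼Nᵢ (≼-⋁ k Ns i))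
      (down-closed _ K P⋁Ns)
      where
      P⋁Ns : P (⋁ k Ns)
      P⋁Ns = ⋁-closed P ∨-closed k Ns (λ i → Equivalence.from (P≐ (Ns i)) (i , ≼-refl))

    from : (Σ A λ N → ∀ K → P K ⇔ Cone N K) →
           Σ ℕ λ k → Σ (Fin k → A) λ Ns → ∀ K → P K ⇔ Σ (Fin k) (λ i → Cone (Ns i) K)
    from (N , P≐) = 1 , (λ _ → N) , λ K → mk⇔
      (λ PK → zero , Equivalence.to (P≐ K) PK)
      (λ { (_ , K≼N) → Equivalence.from (P≐ K) K≼N })

module _ {M : Set} where

  ≤B-refl : {N : B M} → N ≤B N
  ≤B-refl r Nr = Nr

  ≤B-trans : {N₁ N₂ N₃ : B M} → N₁ ≤B N₂ → N₂ ≤B N₃ → N₁ ≤B N₃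
  ≤B-trans N₁≤N₂ N₂≤N₃ r N₁r = N₂≤N₃ r (N₁≤N₂ r N₁r)

  module Lower = JoinPreorder (_≤B_ {M}) ≤B-refl ≤B-trans _∪B_ (λ r → inj₁) (λ r → inj₂)

  module Upper = JoinPreorder (flip (_≤B_ {M})) ≤B-refl (flip ≤B-trans) _∩B_
                   (λ r → proj₁) (λ r → proj₂)

corollary4p2 : ((M : Set) (𝓜 : Structure M) → Regular 𝓜 → (P : Property M) →
    NonEmpty P → ClosedLower P → LProperty P →
    IsFinUnionOfLowerCones P ⇔ IsLowerCone P)
    ×
    ((M : Set) (𝓜 : Structure M) → Regular 𝓜 → (P : Property M) →
    NonEmpty P → ClosedUpper P → LProperty P →
    IsFinUnionOfUpperCones P ⇔ IsUpperCone P)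
corollary4p2 =
  (λ _ _ _ P nonEmpty closed (∪-closed , _) →
     Lower.finUnionOfCones⇔cone P nonEmpty closed ∪-closed) ,
  (λ _ _ _ P nonEmpty closed (_ , ∩-closed) →
     Upper.finUnionOfCones⇔cone P nonEmpty closed ∩-closed)
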